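{- For any positive integers $k,n$ with $k\le n$, $$ex_v(\overrightarrow{P_k},\overrightarrow{Q_n})=\max_{j\in [k]}\left\{\sum_{\substack{0\le i\le n\\ i\not\equiv j \pmod k}}\binom{n}{i}\right\}.$$
   Context: The oriented hypercube $\overrightarrow{Q_n}$ has vertex set $\{0,1\}^n$ (identified with the subsets of $[n]$); for every $A\subseteq[n]$ and $x\notin A$ there is a directed edge from $A$ to $A\cup\{x\}$, and no other edges. $\overrightarrow{P_k}$ is the directed path on $k$ vertices $v_1,\dots,v_k$ with edges from $v_i$ to $v_{i+1}$ for each $i<k$. For an oriented graph $\overrightarrow{F}$, $ex_v(\overrightarrow{F},\overrightarrow{Q_n})$ is the maximum size of a vertex subset $U$ of $\overrightarrow{Q_n}$ such that the induced subgraph $\overrightarrow{Q_n}[U]$ contains no subgraph isomorphic to $\overrightarrow{F}$ as a directed graph. $[k]=\{1,\dots,k\}$. -}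

module Defs where

open import Data.Nat using (ℕ; zero; suc; _+_; _⊔_; _≡ᵇ_; _≤_; NonZero)
open import Data.Empty using (⊥)
open import Data.Nat.DivMod using (_%_)
open import Data.Nat.Combinatorics using (_C_)
open import Data.Bool using (Bool; true; false; if_then_else_; T)
open import Data.Fin using (Fin; toℕ)
open import Data.Fin.Subset using (Subset; _∉_; _∪_; ⁅_⁆; _∈_)
open import Data.List using (List; []; _∷_; map; foldr; upTo; _++_)
open import Data.Nat.ListAction using (sum)
open import Data.Vec using (Vec; []; _∷_)
open import Data.Product using (Σ; ∃; _×_)
open import Relation.Binary.PropositionalEquality using (_≡_)
open import Function.Definitions using (Injective)

Vertex : ℕ → Set
Vertex n = Subset n

Edge : {n : ℕ} → Vertex n → Vertex n → Set
Edge A B = ∃ λ x → (x ∉ A) × (B ≡ A ∪ ⁅ x ⁆)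

allVertices : (n : ℕ) → List (Vertex n)
allVertices zero = [] ∷ []
allVertices (suc n) = map (true ∷_) (allVertices n) ++ map (false ∷_) (allVertices n)

VertexSet : ℕ → Set
VertexSet n = Vertex n → Bool

size : {n : ℕ} → VertexSet n → ℕ
size {n} U = sum (map (λ v → if U v then 1 else 0) (allVertices n))

ContainsPath : {n : ℕ} → (k : ℕ) → VertexSet n → Set
ContainsPath {n} k U =
  Σ (Fin k → Vertex n) λ f →
    Injective _≡_ _≡_ f
    × (∀ i → T (U (f i)))
    × (∀ (i j : Fin k) → toℕ j ≡ suc (toℕ i) → Edge (f i) (f j))

PathFree : {n : ℕ} → (k : ℕ) → VertexSet n → Set
PathFree k U = ContainsPath k U → ⊥

sumNotCong : (k n j : ℕ) → .{{NonZero k}} → ℕ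
sumNotCong k n j = sum (map (λ i → if (i % k) ≡ᵇ (j % k) then 0 else n C i) (upTo (suc n)))

rhs : (k n : ℕ) → .{{NonZero k}} → ℕ
rhs k n = foldr _⊔_ 0 (map (λ j → sumNotCong k n (suc j)) (upTo k))

IsExV : (k n M : ℕ) → Set
IsExV k n M =
  (Σ (VertexSet n) λ U → PathFree k U × size U ≡ M)
  × (∀ (U : VertexSet n) → PathFree k U → size U ≤ M)

-- Lower bound: along a directed path of Qₙ the levels ∣v∣ are consecutive integers, so the
-- vertices whose level avoids one residue class modulo k contain no copy of P_k; the best
-- residue class gives the right-hand side.
--
-- Upper bound, by averaging over the n! maximal chains ∅ = σ 0 ⊂ ⋯ ⊂ σ n of Qₙ: if U has no
-- P_k, the levels i with σ i ∉ U meet every window of k consecutive levels, and a set of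
-- levels meeting every window has binomial weight ∑ C(n,i) at least that of some full
-- residue class, hence at least 2ⁿ − rhs. Every vertex B lies on ∣B∣! (n − ∣B∣)! maximal
-- chains, so summing these weights over all chains counts each vertex outside U exactly
-- n! times, giving 2ⁿ − ∣U∣ ≥ 2ⁿ − rhs.

module Submission where

open import Defs

import Algebra.Properties.CommutativeSemigroup as CommSemigroupProperties
open import Data.Bool.Base using (true; false; if_then_else_; T)
open import Data.Bool.Properties using (∨-identityʳ; if-not)
open import Data.Fin.Base using (Fin; zero; suc; toℕ; fromℕ<)
open import Data.Fin.Properties using (toℕ-fromℕ<; toℕ-injective; toℕ<n)
open import Data.Fin.Subset using (∣_∣; _∪_; ⁅_⁆; _∉_)
open import Data.Fin.Subset.Properties using (∪-identityʳ; ∣p∣≤n)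
open import Data.List.Base using (applyUpTo; map; foldr; upTo; _++_)
open import Data.List.Properties using (map-upTo; map-++; map-∘)
open import Data.Nat.Base
open import Data.Nat.Combinatorics
  using (_C_; nCk+nC[k+1]≡[n+1]C[k+1]; nCk≡n!/k![n-k]!; k![n∸k]!∣n!; [n-k]*d[k+1]≡[k+1]*d[k]; k>n⇒nCk≡0)
open import Data.Nat.DivMod
  using ( m/n*n≡m; m≡m%n+[m/n]*n; m%n<n; m%n≤n; m%n≤m; m/n≤m; n%n≡0; m%n%n≡m%n
        ; %-distribˡ-+; [m+n]%n≡m%n; [m+kn]%n≡m%n; m<n⇒m%n≡m)
open import Data.Nat.ListAction using (sum)
open import Data.Nat.ListAction.Properties using (sum-++)
open import Data.Nat.Properties
open import Data.Nat.Solver using (module +-*-Solver)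
open import Data.Product.Base using (∃; _×_; _,_)
open import Data.Sum.Base using (_⊎_; inj₁; inj₂; [_,_]′)
open import Data.Vec.Base using ([]; _∷_; here; there)
open import Function.Base using (_∘_)
open import Function.Definitions using (Injective)
open import Relation.Binary.Definitions using (tri<; tri≈; tri>)
open import Relation.Binary.PropositionalEquality
open import Relation.Nullary.Decidable using (Dec; yes; no; does; ¬?; T?; _×-dec_; decidable-stable)
open import Relation.Nullary.Negation using (¬_; contradiction)
open import Relation.Unary using (Decidable)

module +-CS = CommSemigroupProperties +-commutativeSemigroup
module *-CS = CommSemigroupProperties *-commutativeSemigroup

-- Finite sums

∑< : ℕ → (ℕ → ℕ) → ℕ
∑< m f = sum (applyUpTo f m)

infix 5 ∑<
syntax ∑< m (λ i → e) = ∑[ i < m ] e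

∑-cong : ∀ m {f g : ℕ → ℕ} → (∀ i → i < m → f i ≡ g i) → ∑< m f ≡ ∑< m g
∑-cong zero    f≗g = refl
∑-cong (suc m) f≗g = cong₂ _+_ (f≗g 0 z<s) (∑-cong m (λ i i<m → f≗g (suc i) (s<s i<m)))

∑-mono-≤ : ∀ m {f g : ℕ → ℕ} → (∀ i → i < m → f i ≤ g i) → ∑< m f ≤ ∑< m g
∑-mono-≤ zero    f≤g = z≤n
∑-mono-≤ (suc m) f≤g = +-mono-≤ (f≤g 0 z<s) (∑-mono-≤ m (λ i i<m → f≤g (suc i) (s<s i<m)))

∑-distrib-+ : ∀ m (f g : ℕ → ℕ) → ∑[ i < m ] f i + g i ≡ ∑< m f + ∑< m g
∑-distrib-+ zero    f g = refl
∑-distrib-+ (suc m) f g =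
  trans (cong (f 0 + g 0 +_) (∑-distrib-+ m (f ∘ suc) (g ∘ suc))) (+-CS.interchange (f 0) (g 0) _ _)

∑-const : ∀ m c → ∑[ i < m ] c ≡ m * c
∑-const zero    c = refl
∑-const (suc m) c = cong (c +_) (∑-const m c)

∑-zero : ∀ m {f : ℕ → ℕ} → (∀ i → i < m → f i ≡ 0) → ∑< m f ≡ 0
∑-zero m f≗0 = trans (∑-cong m f≗0) (trans (∑-const m 0) (*-zeroʳ m))

∑-swap : ∀ m l (a : ℕ → ℕ → ℕ) → ∑[ r < m ] ∑[ i < l ] a r i ≡ ∑[ i < l ] ∑[ r < m ] a r i
∑-swap zero    l a = sym (∑-zero l (λ _ _ → refl))
∑-swap (suc m) l a =
  trans (cong (∑< l (a 0) +_) (∑-swap m l (a ∘ suc))) (sym (∑-distrib-+ l (a 0) _))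

∑-split : ∀ m l (f : ℕ → ℕ) → ∑< (m + l) f ≡ ∑< m f + (∑[ i < l ] f (m + i))
∑-split zero    l f = refl
∑-split (suc m) l f = trans (cong (f 0 +_) (∑-split m l (f ∘ suc))) (sym (+-assoc (f 0) _ _))

∑-snoc : ∀ m (f : ℕ → ℕ) → ∑< (suc m) f ≡ ∑< m f + f m
∑-snoc zero    f = +-identityʳ (f 0)
∑-snoc (suc m) f = trans (cong (f 0 +_) (∑-snoc m (f ∘ suc))) (sym (+-assoc (f 0) _ _))

∑-mono-≤-range : ∀ {m l} (f : ℕ → ℕ) → m ≤ l → ∑< m f ≤ ∑< l f
∑-mono-≤-range {m} {l} f m≤l = begin
  ∑< m f                               ≤⟨ m≤m+n _ _ ⟩
  ∑< m f + (∑[ i < l ∸ m ] f (m + i))  ≡⟨ ∑-split m (l ∸ m) f ⟨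
  ∑< (m + (l ∸ m)) f                   ≡⟨ cong (λ l → ∑< l f) (m+[n∸m]≡n m≤l) ⟩
  ∑< l f                               ∎
  where open ≤-Reasoning

≤-foldr-⊔ : ∀ m (g : ℕ → ℕ) {j} → j < m → g j ≤ foldr _⊔_ 0 (applyUpTo g m)
≤-foldr-⊔ (suc m) g {zero}  _         = m≤m⊔n (g 0) _
≤-foldr-⊔ (suc m) g {suc j} (s<s j<m) = ≤-trans (≤-foldr-⊔ m (g ∘ suc) j<m) (m≤n⊔m (g 0) _)

foldr-⊔-attained : ∀ m (g : ℕ → ℕ) → ∃ λ j → j ≤ m × foldr _⊔_ 0 (applyUpTo g (suc m)) ≡ g j
foldr-⊔-attained zero    g = 0 , z≤n , ⊔-identityʳ (g 0)
foldr-⊔-attained (suc m) g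
  with foldr-⊔-attained m (g ∘ suc) | ⊔-sel (g 0) (foldr _⊔_ 0 (applyUpTo (g ∘ suc) (suc m)))
... | _ , _   , _ | inj₁ max≡g0   = 0 , z≤n , max≡g0
... | j , j≤m , e | inj₂ max≡rest = suc j , s≤s j≤m , trans max≡rest e

_when_ : {P : Set} → ℕ → Dec P → ℕ
x when P? = if does P? then x else 0

infixl 6.4 _when_

module _ {P : Set} where

  when-yes : ∀ x (P? : Dec P) → P → x when P? ≡ x
  when-yes x (yes _) _ = refl
  when-yes x (no ¬p) p = contradiction p ¬p

  when-no : ∀ x (P? : Dec P) → ¬ P → x when P? ≡ 0
  when-no x (yes p) ¬p = contradiction p ¬p
  when-no x (no _)  _  = refl

  when-⇔ : ∀ {Q : Set} x (P? : Dec P) (Q? : Dec Q) → (P → Q) → (Q → P) → x when P? ≡ x when Q?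
  when-⇔ x (yes _) (yes _) _   _   = refl
  when-⇔ x (no _)  (no _)  _   _   = refl
  when-⇔ x (yes p) (no ¬q) p⇒q _   = contradiction (p⇒q p) ¬q
  when-⇔ x (no ¬p) (yes q) _   q⇒p = contradiction (q⇒p q) ¬p

T-¬?⇒¬ : ∀ {P : Set} (P? : Dec P) → T (does (¬? P?)) → ¬ P
T-¬?⇒¬ (no ¬p) _ = ¬p

*-distribˡ-when : ∀ {P : Set} x y (P? : Dec P) → x * (y when P?) ≡ (x * y) when P?
*-distribˡ-when x y (yes _) = refl
*-distribˡ-when x y (no _)  = *-zeroʳ x

when-+-when-¬ : ∀ {P : Set} x (P? : Dec P) → x when P? + x when ¬? P? ≡ x
when-+-when-¬ x (yes _) = +-identityʳ x
when-+-when-¬ x (no _)  = refl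

∑-point : ∀ m a (f : ℕ → ℕ) → a < m → ∑[ i < m ] f i when (i ≟ a) ≡ f a
∑-point (suc m) zero    f _         = trans (cong (f 0 +_) (∑-zero m (λ _ _ → refl))) (+-identityʳ (f 0))
∑-point (suc m) (suc a) f (s<s a<m) = ∑-point m a (f ∘ suc) a<m

module _ {P : ℕ → Set} (P? : Decidable P) where

  first? : ∀ m → (∀ {i} → i < m → ¬ P i) ⊎ ∃ λ t → t < m × P t × (∀ {i} → i < t → ¬ P i)
  first? zero = inj₁ λ ()
  first? (suc m) with first? m
  ... | inj₂ (t , t<m , Pt , before) = inj₂ (t , m<n⇒m<1+n t<m , Pt , before)
  ... | inj₁ none with P? m
  ...   | yes Pm = inj₂ (m , n<1+n m , Pm , none)
  ...   | no ¬Pm = inj₁ λ i<1+m → [ none , (λ { refl → ¬Pm }) ]′ (m<1+n⇒m<n∨m≡n i<1+m)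

  last? : ∀ m → (∀ {i} → i < m → ¬ P i) ⊎ ∃ λ t → t < m × P t × (∀ {i} → t < i → i < m → ¬ P i)
  last? zero = inj₁ λ ()
  last? (suc m) with P? m
  ... | yes Pm = inj₂ (m , n<1+n m , Pm , λ m<i i<1+m → contradiction (s≤s⁻¹ i<1+m) (<⇒≱ m<i))
  ... | no ¬Pm with last? m
  ...   | inj₁ none = inj₁ λ i<1+m → [ none , (λ { refl → ¬Pm }) ]′ (m<1+n⇒m<n∨m≡n i<1+m)
  ...   | inj₂ (t , t<m , Pt , after) = inj₂ (t , m<n⇒m<1+n t<m , Pt ,
            λ t<i i<1+m → [ after t<i , (λ { refl → ¬Pm }) ]′ (m<1+n⇒m<n∨m≡n i<1+m))

-- Sums over the vertices of Qₙ

∑ᵥ : (n : ℕ) → (Vertex n → ℕ) → ℕ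
∑ᵥ zero    g = g []
∑ᵥ (suc n) g = ∑ᵥ n (g ∘ (true ∷_)) + ∑ᵥ n (g ∘ (false ∷_))

sum-allVertices : ∀ n (g : Vertex n → ℕ) → sum (map g (allVertices n)) ≡ ∑ᵥ n g
sum-allVertices zero    g = +-identityʳ (g [])
sum-allVertices (suc n) g = begin
  sum (map g (map (true ∷_) vs ++ map (false ∷_) vs))
    ≡⟨ cong sum (map-++ g (map (true ∷_) vs) _) ⟩
  sum (map g (map (true ∷_) vs) ++ map g (map (false ∷_) vs))
    ≡⟨ sum-++ (map g (map (true ∷_) vs)) _ ⟩
  sum (map g (map (true ∷_) vs)) + sum (map g (map (false ∷_) vs))
    ≡⟨ cong₂ _+_ (cong sum (map-∘ vs)) (cong sum (map-∘ vs)) ⟨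
  sum (map (g ∘ (true ∷_)) vs) + sum (map (g ∘ (false ∷_)) vs)
    ≡⟨ cong₂ _+_ (sum-allVertices n _) (sum-allVertices n _) ⟩
  ∑ᵥ (suc n) g ∎
  where
  open ≡-Reasoning
  vs = allVertices n

∑ᵥ-cong : ∀ n {f g : Vertex n → ℕ} → (∀ v → f v ≡ g v) → ∑ᵥ n f ≡ ∑ᵥ n g
∑ᵥ-cong zero    f≗g = f≗g []
∑ᵥ-cong (suc n) f≗g = cong₂ _+_ (∑ᵥ-cong n (f≗g ∘ (true ∷_))) (∑ᵥ-cong n (f≗g ∘ (false ∷_)))

∑ᵥ-distrib-+ : ∀ n (f g : Vertex n → ℕ) → ∑ᵥ n (λ v → f v + g v) ≡ ∑ᵥ n f + ∑ᵥ n g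
∑ᵥ-distrib-+ zero    f g = refl
∑ᵥ-distrib-+ (suc n) f g =
  trans (cong₂ _+_ (∑ᵥ-distrib-+ n (f ∘ (true ∷_)) (g ∘ (true ∷_)))
                   (∑ᵥ-distrib-+ n (f ∘ (false ∷_)) (g ∘ (false ∷_))))
        (+-CS.interchange (∑ᵥ n (f ∘ (true ∷_))) _ _ _)

∑ᵥ-distribˡ-* : ∀ n c (f : Vertex n → ℕ) → ∑ᵥ n (λ v → c * f v) ≡ c * ∑ᵥ n f
∑ᵥ-distribˡ-* zero    c f = refl
∑ᵥ-distribˡ-* (suc n) c f =
  trans (cong₂ _+_ (∑ᵥ-distribˡ-* n c _) (∑ᵥ-distribˡ-* n c _)) (sym (*-distribˡ-+ c _ _))

∑ᵥ-by-level : ∀ n N (g : ℕ → ℕ) → n < N → ∑ᵥ n (g ∘ ∣_∣) ≡ ∑[ i < N ] (n C i) * g i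
∑ᵥ-by-level zero    (suc N) g _         = sym (begin
  1 * g 0 + (∑[ i < N ] 0)  ≡⟨ cong (1 * g 0 +_) (∑-zero N λ _ _ → refl) ⟩
  1 * g 0 + 0               ≡⟨ +-identityʳ _ ⟩
  1 * g 0                   ≡⟨ *-identityˡ (g 0) ⟩
  g 0                       ∎)
  where open ≡-Reasoning
∑ᵥ-by-level (suc n) (suc N) g (s<s n<N) = begin
  ∑ᵥ n (g ∘ suc ∘ ∣_∣) + ∑ᵥ n (g ∘ ∣_∣)
    ≡⟨ cong₂ _+_ (∑ᵥ-by-level n N (g ∘ suc) n<N) (∑ᵥ-by-level n (suc N) g (m<n⇒m<1+n n<N)) ⟩
  (∑[ i < N ] (n C i) * g (suc i)) + (1 * g 0 + (∑[ i < N ] (n C suc i) * g (suc i)))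
    ≡⟨ +-CS.x∙yz≈y∙xz (∑[ i < N ] (n C i) * g (suc i)) (1 * g 0) _ ⟩
  1 * g 0 + ((∑[ i < N ] (n C i) * g (suc i)) + (∑[ i < N ] (n C suc i) * g (suc i)))
    ≡⟨ cong (1 * g 0 +_) (∑-distrib-+ N _ _) ⟨
  1 * g 0 + (∑[ i < N ] (n C i) * g (suc i) + (n C suc i) * g (suc i))
    ≡⟨ cong (1 * g 0 +_) (∑-cong N λ i _ → pascal i) ⟩
  ∑[ i < suc N ] (suc n C i) * g i ∎
  where
  open ≡-Reasoning
  pascal : ∀ i → (n C i) * g (suc i) + (n C suc i) * g (suc i) ≡ (suc n C suc i) * g (suc i)
  pascal i = trans (sym (*-distribʳ-+ (g (suc i)) (n C i) _)) (cong (_* g (suc i)) (nCk+nC[k+1]≡[n+1]C[k+1] n i))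

-- Edges and directed paths

x∉p⇒∣p∪⁅x⁆∣≡1+∣p∣ : ∀ {n} {x : Fin n} (p : Vertex n) → x ∉ p → ∣ p ∪ ⁅ x ⁆ ∣ ≡ suc ∣ p ∣
x∉p⇒∣p∪⁅x⁆∣≡1+∣p∣ {x = zero}  (true  ∷ p) x∉p = contradiction here x∉p
x∉p⇒∣p∪⁅x⁆∣≡1+∣p∣ {x = zero}  (false ∷ p) _   = cong (suc ∘ ∣_∣) (∪-identityʳ p)
x∉p⇒∣p∪⁅x⁆∣≡1+∣p∣ {x = suc x} (true  ∷ p) x∉p = cong suc (x∉p⇒∣p∪⁅x⁆∣≡1+∣p∣ p (x∉p ∘ there))
x∉p⇒∣p∪⁅x⁆∣≡1+∣p∣ {x = suc x} (false ∷ p) x∉p = x∉p⇒∣p∪⁅x⁆∣≡1+∣p∣ p (x∉p ∘ there)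

edge-∣∣ : ∀ {n} {A B : Vertex n} → Edge A B → ∣ B ∣ ≡ suc ∣ A ∣
edge-∣∣ {A = A} (x , x∉A , refl) = x∉p⇒∣p∪⁅x⁆∣≡1+∣p∣ A x∉A

edge-new : ∀ {n} (A : Vertex n) → Edge (false ∷ A) (true ∷ A)
edge-new A = zero , (λ ()) , cong (true ∷_) (sym (∪-identityʳ A))

edge-∷ : ∀ {n} b {A B : Vertex n} → Edge A B → Edge (b ∷ A) (b ∷ B)
edge-∷ b (x , x∉A , refl) = suc x , (λ { (there x∈A) → x∉A x∈A }) , cong (_∷ _) (sym (∨-identityʳ b))

path-level : ∀ {n k} (f : Fin k → Vertex n) → (∀ i j → toℕ j ≡ suc (toℕ i) → Edge (f i) (f j)) →
             ∀ d {i j} → toℕ j ≡ toℕ i + d → ∣ f j ∣ ≡ ∣ f i ∣ + d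
path-level f edges zero    {i} {j} j≡i+0   =
  trans (cong (∣_∣ ∘ f) (toℕ-injective (trans j≡i+0 (+-identityʳ _)))) (sym (+-identityʳ _))
path-level {k = k} f edges (suc d) {i} {j} j≡i+1+d = begin
  ∣ f j ∣            ≡⟨ edge-∣∣ (edges j′ j (trans j≡1+[i+d] (cong suc (sym (toℕ-fromℕ< i+d<k))))) ⟩
  suc ∣ f j′ ∣       ≡⟨ cong suc (path-level f edges d (toℕ-fromℕ< i+d<k)) ⟩
  suc (∣ f i ∣ + d)  ≡⟨ +-suc _ d ⟨
  ∣ f i ∣ + suc d    ∎
  where
  open ≡-Reasoning
  j≡1+[i+d] = trans j≡i+1+d (+-suc (toℕ i) d)
  i+d<k = <-trans (n<1+n _) (subst (_< k) j≡1+[i+d] (toℕ<n j))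
  j′ = fromℕ< i+d<k

-- Maximal chains

splice : {A : Set} → ℕ → (ℕ → A) → (ℕ → A) → ℕ → A
splice r       f g zero    = f zero
splice zero    f g (suc i) = g i
splice (suc r) f g (suc i) = splice r (f ∘ suc) (g ∘ suc) i

module _ {A : Set} where

  splice-≤ : ∀ {r i} (f g : ℕ → A) → i ≤ r → splice r f g i ≡ f i
  splice-≤ {r}     {zero}  f g _         = refl
  splice-≤ {suc r} {suc i} f g (s≤s i≤r) = splice-≤ (f ∘ suc) (g ∘ suc) i≤r

  splice-> : ∀ {r i} (f g : ℕ → A) → r ≤ i → splice r f g (suc i) ≡ g i
  splice-> {zero}  {i}     f g _         = refl
  splice-> {suc r} {suc i} f g (s≤s r≤i) = splice-> (f ∘ suc) (g ∘ suc) r≤i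

  splice-natural : ∀ {B : Set} (h : ℕ → A → B) r (f g : ℕ → A) i →
                   h i (splice r f g i) ≡ splice r (λ j → h j (f j)) (λ j → h (suc j) (g j)) i
  splice-natural h r       f g zero    = refl
  splice-natural h zero    f g (suc i) = refl
  splice-natural h (suc r) f g (suc i) = splice-natural (h ∘ suc) r (f ∘ suc) (g ∘ suc) i

-- Writing i ≤ r as i <? suc r makes the shift of both indices in the recursion definitional.
∑-splice : ∀ m r (f g : ℕ → ℕ) → r ≤ m →
           ∑[ i < suc (suc m) ] splice r f g i ≡ ∑[ i < suc m ] f i when (i <? suc r) + g i when (r <? suc i)
∑-splice m       zero    f g _         = sym (+-assoc (f 0) (g 0) _)
∑-splice (suc m) (suc r) f g (s≤s r≤m) =
  trans (cong (f 0 +_) (∑-splice m r (f ∘ suc) (g ∘ suc) r≤m))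
        (cong (_+ (∑[ i < suc m ] f (suc i) when (i <? suc r) + g (suc i) when (r <? suc i)))
              (sym (+-identityʳ (f 0))))

∑-count-≥ : ∀ M i x → ∑[ r < M ] x when (i <? suc r) ≡ (M ∸ i) * x
∑-count-≥ zero    i       x = cong (_* x) (sym (0∸n≡0 i))
∑-count-≥ (suc M) zero    x = cong (x +_) (∑-const M x)
∑-count-≥ (suc M) (suc i) x = ∑-count-≥ M i x

∑-count-≤ : ∀ M i x → i < M → ∑[ r < M ] x when (r <? suc i) ≡ suc i * x
∑-count-≤ (suc M) zero    x _         = cong (x +_) (∑-zero M λ _ _ → refl)
∑-count-≤ (suc M) (suc i) x (s<s i<M) = cong (x +_) (∑-count-≤ M i x i<M)

-- Only σ 0, …, σ n are constrained; later values are junk.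
Chain : ℕ → Set
Chain n = ℕ → Vertex n

record IsMaximalChain {n} (σ : Chain n) : Set where
  field
    ∣σ∣≡ : ∀ {i} → i ≤ n → ∣ σ i ∣ ≡ i
    edge : ∀ {i} → i < n → Edge (σ i) (σ (suc i))

insert : ∀ {m} → Chain m → ℕ → Chain (suc m)
insert τ r = splice r ((false ∷_) ∘ τ) ((true ∷_) ∘ τ)

insert-isMaximalChain : ∀ {m} {τ : Chain m} {r} → IsMaximalChain τ → r ≤ m → IsMaximalChain (insert τ r)
insert-isMaximalChain {m} {τ} {r} τ-max r≤m = record { ∣σ∣≡ = ∣σ∣≡ ; edge = edge }
  where
  open IsMaximalChain τ-max renaming (∣σ∣≡ to ∣τ∣≡; edge to τ-edge)
  σ₀ : Chain (suc m)
  σ₀ = (false ∷_) ∘ τ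
  σ₁ : Chain (suc m)
  σ₁ = (true ∷_) ∘ τ
  ∣σ∣≡ : ∀ {i} → i ≤ suc m → ∣ insert τ r i ∣ ≡ i
  ∣σ∣≡ {i} i≤1+m with ≤-<-connex i r
  ... | inj₁ i≤r       = trans (cong ∣_∣ (splice-≤ σ₀ σ₁ i≤r)) (∣τ∣≡ (≤-trans i≤r r≤m))
  ... | inj₂ (s≤s r≤j) = trans (cong ∣_∣ (splice-> σ₀ σ₁ r≤j)) (cong suc (∣τ∣≡ (s≤s⁻¹ i≤1+m)))
  edge : ∀ {i} → i < suc m → Edge (insert τ r i) (insert τ r (suc i))
  edge {i} i<1+m with <-cmp i r
  ... | tri< i<r _ _ = subst₂ Edge (sym (splice-≤ σ₀ σ₁ (<⇒≤ i<r))) (sym (splice-≤ σ₀ σ₁ i<r))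
                         (edge-∷ false (τ-edge (<-≤-trans i<r r≤m)))
  ... | tri≈ _ refl _ = subst₂ Edge (sym (splice-≤ σ₀ σ₁ ≤-refl)) (sym (splice-> σ₀ σ₁ ≤-refl)) (edge-new (τ i))
  ... | tri> _ _ (s≤s r≤j) = subst₂ Edge (sym (splice-> σ₀ σ₁ r≤j)) (sym (splice-> σ₀ σ₁ (m≤n⇒m≤1+n r≤j)))
                               (edge-∷ true (τ-edge (s≤s⁻¹ i<1+m)))

-- The sum over the n! maximal chains: a maximal chain of Q_{m+1} is a maximal chain τ of
-- Q_m together with the step r ≤ m at which the new coordinate enters.
∑ᶜ : (n : ℕ) → (Chain n → ℕ) → ℕ
∑ᶜ zero    Φ = Φ (λ _ → [])
∑ᶜ (suc m) Φ = ∑ᶜ m (λ τ → ∑[ r < suc m ] Φ (insert τ r))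

∑ᶜ-cong : ∀ n {Φ Ψ : Chain n → ℕ} → (∀ σ → Φ σ ≡ Ψ σ) → ∑ᶜ n Φ ≡ ∑ᶜ n Ψ
∑ᶜ-cong zero    Φ≗Ψ = Φ≗Ψ _
∑ᶜ-cong (suc m) Φ≗Ψ = ∑ᶜ-cong m λ τ → ∑-cong (suc m) λ r _ → Φ≗Ψ (insert τ r)

∑ᶜ-mono-≤ : ∀ n {Φ Ψ : Chain n → ℕ} → (∀ σ → IsMaximalChain σ → Φ σ ≤ Ψ σ) → ∑ᶜ n Φ ≤ ∑ᶜ n Ψ
∑ᶜ-mono-≤ zero    Φ≤Ψ = Φ≤Ψ _ (record { ∣σ∣≡ = λ { z≤n → refl } ; edge = λ () })
∑ᶜ-mono-≤ (suc m) Φ≤Ψ = ∑ᶜ-mono-≤ m λ τ τ-max →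
  ∑-mono-≤ (suc m) λ r r<1+m → Φ≤Ψ (insert τ r) (insert-isMaximalChain τ-max (s≤s⁻¹ r<1+m))

∑ᶜ-const : ∀ n c → ∑ᶜ n (λ _ → c) ≡ n ! * c
∑ᶜ-const zero    c = sym (+-identityʳ c)
∑ᶜ-const (suc m) c = begin
  ∑ᶜ m (λ _ → ∑[ r < suc m ] c)  ≡⟨ ∑ᶜ-cong m (λ _ → ∑-const (suc m) c) ⟩
  ∑ᶜ m (λ _ → suc m * c)         ≡⟨ ∑ᶜ-const m (suc m * c) ⟩
  m ! * (suc m * c)              ≡⟨ *-assoc (m !) (suc m) c ⟨
  m ! * suc m * c                ≡⟨ cong (_* c) (*-comm (m !) (suc m)) ⟩
  suc m ! * c                    ∎
  where open ≡-Reasoning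

∑-insert : ∀ {m} (τ : Chain m) (G : ℕ → Vertex (suc m) → ℕ) →
           ∑[ r < suc m ] ∑[ i < suc (suc m) ] G i (insert τ r i)
             ≡ ∑[ i < suc m ] (suc m ∸ i) * G i (false ∷ τ i) + suc i * G (suc i) (true ∷ τ i)
∑-insert {m} τ G = begin
  ∑[ r < suc m ] ∑[ i < suc (suc m) ] G i (insert τ r i)
    ≡⟨ ∑-cong (suc m) (λ r r<1+m → spliced r (s≤s⁻¹ r<1+m)) ⟩
  ∑[ r < suc m ] ∑[ i < suc m ] G₀ i when (i <? suc r) + G₁ i when (r <? suc i)
    ≡⟨ ∑-swap (suc m) (suc m) (λ r i → G₀ i when (i <? suc r) + G₁ i when (r <? suc i)) ⟩
  ∑[ i < suc m ] ∑[ r < suc m ] G₀ i when (i <? suc r) + G₁ i when (r <? suc i)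
    ≡⟨ ∑-cong (suc m) counted ⟩
  ∑[ i < suc m ] (suc m ∸ i) * G₀ i + suc i * G₁ i ∎
  where
  open ≡-Reasoning
  G₀ G₁ : ℕ → ℕ
  G₀ i = G i (false ∷ τ i)
  G₁ i = G (suc i) (true ∷ τ i)
  spliced : ∀ r → r ≤ m →
            ∑[ i < suc (suc m) ] G i (insert τ r i) ≡ ∑[ i < suc m ] G₀ i when (i <? suc r) + G₁ i when (r <? suc i)
  spliced r r≤m = trans (∑-cong (suc (suc m)) λ i _ → splice-natural G r ((false ∷_) ∘ τ) ((true ∷_) ∘ τ) i)
                        (∑-splice m r G₀ G₁ r≤m)
  counted : ∀ i → i < suc m →
            ∑[ r < suc m ] G₀ i when (i <? suc r) + G₁ i when (r <? suc i) ≡ (suc m ∸ i) * G₀ i + suc i * G₁ i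
  counted i i<1+m = trans (∑-distrib-+ (suc m) (λ r → G₀ i when (i <? suc r)) (λ r → G₁ i when (r <? suc i)))
                          (cong₂ _+_ (∑-count-≥ (suc m) i (G₀ i)) (∑-count-≤ (suc m) i (G₁ i) i<1+m))

∑ᶜ-by-vertex : ∀ n (G : ℕ → Vertex n → ℕ) →
               ∑ᶜ n (λ σ → ∑[ i < suc n ] G i (σ i))
                 ≡ ∑ᵥ n (λ B → ∣ B ∣ ! * (n ∸ ∣ B ∣) ! * G ∣ B ∣ B)
∑ᶜ-by-vertex zero    G = refl
∑ᶜ-by-vertex (suc m) G = begin
  ∑ᶜ m (λ τ → ∑[ r < suc m ] ∑[ i < suc (suc m) ] G i (insert τ r i))
    ≡⟨ ∑ᶜ-cong m (λ τ → ∑-insert τ G) ⟩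
  ∑ᶜ m (λ τ → ∑[ i < suc m ] G′ i (τ i))
    ≡⟨ ∑ᶜ-by-vertex m G′ ⟩
  ∑ᵥ m (λ w → ∣ w ∣ ! * (m ∸ ∣ w ∣) ! * G′ ∣ w ∣ w)
    ≡⟨ ∑ᵥ-cong m (λ w → split ∣ w ∣ (∣p∣≤n w) (G ∣ w ∣ (false ∷ w)) (G (suc ∣ w ∣) (true ∷ w))) ⟩
  ∑ᵥ m (λ w → suc ∣ w ∣ ! * (m ∸ ∣ w ∣) ! * G (suc ∣ w ∣) (true ∷ w)
             + ∣ w ∣ ! * (suc m ∸ ∣ w ∣) ! * G ∣ w ∣ (false ∷ w))
    ≡⟨ ∑ᵥ-distrib-+ m _ _ ⟩
  ∑ᵥ (suc m) (λ B → ∣ B ∣ ! * (suc m ∸ ∣ B ∣) ! * G ∣ B ∣ B) ∎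
  where
  open ≡-Reasoning
  G′ : ℕ → Vertex m → ℕ
  G′ i w = (suc m ∸ i) * G i (false ∷ w) + suc i * G (suc i) (true ∷ w)
  split : ∀ c → c ≤ m → ∀ x y → c ! * (m ∸ c) ! * ((suc m ∸ c) * x + suc c * y)
                                ≡ suc c ! * (m ∸ c) ! * y + c ! * (suc m ∸ c) ! * x
  split c c≤m x y rewrite +-∸-assoc 1 c≤m = solve 6
    (λ c d c! d! x y → c! :* d! :* ((con 1 :+ d) :* x :+ (con 1 :+ c) :* y)
                      := (con 1 :+ c) :* c! :* d! :* y :+ c! :* ((con 1 :+ d) :* d!) :* x)
    refl c (m ∸ c) (c !) ((m ∸ c) !) x y
    where open +-*-Solver

-- Binomial coefficients

nCk*k![n∸k]!≡n! : ∀ {n k} → k ≤ n → (n C k) * (k ! * (n ∸ k) !) ≡ n !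
nCk*k![n∸k]!≡n! {n} {k} k≤n =
  trans (cong (_* (k ! * (n ∸ k) !)) (nCk≡n!/k![n-k]! k≤n)) (m/n*n≡m (k![n∸k]!∣n! k≤n))
  where instance _ = k !* (n ∸ k) !≢0

nC[1+k]*[1+k]≡nCk*[n∸k] : ∀ n k → (n C suc k) * suc k ≡ (n C k) * (n ∸ k)
nC[1+k]*[1+k]≡nCk*[n∸k] n k with <-≤-connex k n
... | inj₂ n≤k = begin
  (n C suc k) * suc k  ≡⟨ cong (_* suc k) (k>n⇒nCk≡0 (s≤s n≤k)) ⟩
  0                    ≡⟨ *-zeroʳ (n C k) ⟨
  (n C k) * 0          ≡⟨ cong ((n C k) *_) (m≤n⇒m∸n≡0 n≤k) ⟨
  (n C k) * (n ∸ k)    ∎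
  where open ≡-Reasoning
... | inj₁ k<n = *-cancelʳ-≡ _ _ (k ! * (n ∸ k) !) {{k !* (n ∸ k) !≢0}} (begin
  (n C suc k) * suc k * (k ! * (n ∸ k) !)              ≡⟨ *-assoc (n C suc k) (suc k) _ ⟩
  (n C suc k) * (suc k * (k ! * (n ∸ k) !))            ≡⟨ cong ((n C suc k) *_) ([n-k]*d[k+1]≡[k+1]*d[k] k<n) ⟨
  (n C suc k) * ((n ∸ k) * (suc k ! * (n ∸ suc k) !))  ≡⟨ *-CS.x∙yz≈y∙xz (n C suc k) (n ∸ k) _ ⟩
  (n ∸ k) * ((n C suc k) * (suc k ! * (n ∸ suc k) !))  ≡⟨ cong ((n ∸ k) *_) (nCk*k![n∸k]!≡n! k<n) ⟩
  (n ∸ k) * n !                                        ≡⟨ cong ((n ∸ k) *_) (nCk*k![n∸k]!≡n! (<⇒≤ k<n)) ⟨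
  (n ∸ k) * ((n C k) * (k ! * (n ∸ k) !))              ≡⟨ *-CS.x∙yz≈y∙xz (n ∸ k) (n C k) _ ⟩
  (n C k) * ((n ∸ k) * (k ! * (n ∸ k) !))              ≡⟨ *-assoc (n C k) (n ∸ k) _ ⟨
  (n C k) * (n ∸ k) * (k ! * (n ∸ k) !)                ∎)
  where open ≡-Reasoning

nCk≤nC[1+k] : ∀ {n k} → suc (k + k) ≤ n → n C k ≤ n C suc k
nCk≤nC[1+k] {n} {k} 1+2k≤n = *-cancelʳ-≤ _ _ (suc k) (begin
  (n C k) * suc k      ≤⟨ *-monoʳ-≤ (n C k) (m+n≤o⇒m≤o∸n (suc k) 1+2k≤n) ⟩
  (n C k) * (n ∸ k)    ≡⟨ nC[1+k]*[1+k]≡nCk*[n∸k] n k ⟨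
  (n C suc k) * suc k  ∎)
  where open ≤-Reasoning

nC[1+k]≤nCk : ∀ {n k} → n ≤ suc (k + k) → n C suc k ≤ n C k
nC[1+k]≤nCk {n} {k} n≤1+2k = *-cancelʳ-≤ _ _ (suc k) (begin
  (n C suc k) * suc k  ≡⟨ nC[1+k]*[1+k]≡nCk*[n∸k] n k ⟩
  (n C k) * (n ∸ k)    ≤⟨ *-monoʳ-≤ (n C k) (m≤n+o⇒m∸n≤o n k (subst (n ≤_) (sym (+-suc k k)) n≤1+2k)) ⟩
  (n C k) * suc k      ∎)
  where open ≤-Reasoning

nCk-mono-≤ : ∀ {n x y} → x ≤ y → y + y ≤ suc n → n C x ≤ n C y
nCk-mono-≤ {y = zero}  z≤n _ = ≤-refl
nCk-mono-≤ {y = suc y} x≤1+y 2+2y≤1+n with m≤n⇒m<n∨m≡n x≤1+y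
... | inj₂ refl       = ≤-refl
... | inj₁ (s≤s x≤y) = ≤-trans (nCk-mono-≤ x≤y (≤-trans (+-mono-≤ (n≤1+n y) (n≤1+n y)) 2+2y≤1+n))
                               (nCk≤nC[1+k] (s≤s⁻¹ (≤-trans (≤-reflexive (cong suc (sym (+-suc y y)))) 2+2y≤1+n)))

nCk-antimono-≤ : ∀ {n x y} → x ≤ y → n ≤ x + x → n C y ≤ n C x
nCk-antimono-≤ {y = zero}  z≤n _ = ≤-refl
nCk-antimono-≤ {y = suc y} x≤1+y n≤2x with m≤n⇒m<n∨m≡n x≤1+y
... | inj₂ refl       = ≤-refl
... | inj₁ (s≤s x≤y) = ≤-trans (nC[1+k]≤nCk (≤-trans n≤2x (m≤n⇒m≤1+n (+-mono-≤ x≤y x≤y))))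
                               (nCk-antimono-≤ x≤y n≤2x)

-- Residues and arithmetic progressions

r+mk+k≡r+[1+m]k : ∀ {k} r m → r + m * k + k ≡ r + suc m * k
r+mk+k≡r+[1+m]k {k} r m = trans (+-assoc r (m * k) k) (cong (r +_) (+-comm (m * k) k))

∑-progression-cons : ∀ F a k (g : ℕ → ℕ) → ∑[ j < suc F ] g (a + j * k) ≡ g a + (∑[ j < F ] g (a + k + j * k))
∑-progression-cons F a k g = cong₂ _+_ (cong g (+-identityʳ a)) (∑-cong F λ j _ → cong g (sym (+-assoc a k (j * k))))

module _ (k : ℕ) .{{_ : NonZero k}} where

  %-injective-window : ∀ {a b} → a ≤ b → b < a + k → b % k ≡ a % k → b ≡ a
  %-injective-window {a} {b} a≤b b<a+k b%k≡a%k with b / k ≤? a / k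
  ... | yes b/k≤a/k = ≤-antisym (begin
    b                    ≡⟨ m≡m%n+[m/n]*n b k ⟩
    b % k + (b / k) * k  ≤⟨ +-mono-≤ (≤-reflexive b%k≡a%k) (*-monoˡ-≤ k b/k≤a/k) ⟩
    a % k + (a / k) * k  ≡⟨ m≡m%n+[m/n]*n a k ⟨
    a                    ∎) a≤b
    where open ≤-Reasoning
  ... | no b/k≰a/k = contradiction (begin
    a + k                      ≡⟨ cong (_+ k) (m≡m%n+[m/n]*n a k) ⟩
    a % k + (a / k) * k + k    ≡⟨ +-assoc (a % k) _ k ⟩
    a % k + ((a / k) * k + k)  ≡⟨ cong (a % k +_) (+-comm _ k) ⟩
    a % k + suc (a / k) * k    ≤⟨ +-mono-≤ (≤-reflexive (sym b%k≡a%k)) (*-monoˡ-≤ k (≰⇒> b/k≰a/k)) ⟩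
    b % k + (b / k) * k        ≡⟨ m≡m%n+[m/n]*n b k ⟨
    b                          ∎) (<⇒≱ b<a+k)
    where open ≤-Reasoning

  residue-within : ∀ x {r} → r < k → ∃ λ m → m < k × (x + m) % k ≡ r
  residue-within x {r} r<k = (k ∸ s + r) % k , m%n<n _ k , (begin
    (x + (k ∸ s + r) % k) % k      ≡⟨ %-distribˡ-+ x _ k ⟩
    (s + (k ∸ s + r) % k % k) % k  ≡⟨ cong (λ z → (s + z) % k) (m%n%n≡m%n _ k) ⟩
    (s + (k ∸ s + r) % k) % k      ≡⟨ %-distribˡ-+ x (k ∸ s + r) k ⟨
    (x + (k ∸ s + r)) % k          ≡⟨ cong (_% k) x+[k∸s+r]≡r+[1+q]k ⟩
    (r + suc (x / k) * k) % k      ≡⟨ [m+kn]%n≡m%n r (suc (x / k)) k ⟩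
    r % k                          ≡⟨ m<n⇒m%n≡m r<k ⟩
    r                              ∎)
    where
    open ≡-Reasoning
    s = x % k
    x+[k∸s+r]≡r+[1+q]k : x + (k ∸ s + r) ≡ r + suc (x / k) * k
    x+[k∸s+r]≡r+[1+q]k = begin
      x + (k ∸ s + r)                   ≡⟨ cong (_+ (k ∸ s + r)) (m≡m%n+[m/n]*n x k) ⟩
      s + (x / k) * k + (k ∸ s + r)
        ≡⟨ solve 4 (λ s q d r → s :+ q :+ (d :+ r) := r :+ ((s :+ d) :+ q)) refl s ((x / k) * k) (k ∸ s) r ⟩
      r + ((s + (k ∸ s)) + (x / k) * k) ≡⟨ cong (λ z → r + (z + (x / k) * k)) (m+[n∸m]≡n (m%n≤n x k)) ⟩
      r + suc (x / k) * k               ∎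
      where open +-*-Solver

-- Sets of levels meeting every window of k consecutive levels

-- For f increasing up to n/2, decreasing after it and vanishing beyond n: choose t ∈ P with
-- the P-elements below t in the lower half and those above t in the upper half. Going up, the
-- class elements t + k, t + 2k, … are matched one by one with P-elements found in successive
-- windows; each match lies in the upper half and below its class element, so it weighs at
-- least as much. Going down from t is symmetric.
module WindowHitting (n k : ℕ) .{{_ : NonZero k}} (f : ℕ → ℕ)
  (f-mono     : ∀ {x y} → x ≤ y → y + y ≤ suc n → f x ≤ f y)
  (f-antimono : ∀ {x y} → x ≤ y → n ≤ x + x → f y ≤ f x)
  (f-vanish   : ∀ {i} → n < i → f i ≡ 0)
  where

  classFrom? : ∀ a i → Dec (a ≤ i × i % k ≡ a % k)
  classFrom? a i = a ≤? i ×-dec i % k ≟ a % k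

  progression≡class-from : ∀ F a → n < a + F * k →
                           ∑[ j < F ] f (a + j * k) ≡ ∑[ i < suc n ] f i when classFrom? a i
  progression≡class-from zero    a n<a+0 = sym (∑-zero (suc n) λ i i<1+n →
    when-no (f i) (classFrom? a i) λ (a≤i , _) → <⇒≱ (≤-<-trans (s≤s⁻¹ i<1+n) n<a) a≤i)
    where n<a = subst (n <_) (+-identityʳ a) n<a+0
  progression≡class-from (suc F) a n<a+[1+F]k = begin
    ∑[ j < suc F ] f (a + j * k)
      ≡⟨ ∑-progression-cons F a k f ⟩
    f a + (∑[ j < F ] f (a + k + j * k))
      ≡⟨ cong₂ _+_ level (progression≡class-from F (a + k) (subst (n <_) (sym (+-assoc a k _)) n<a+[1+F]k)) ⟩
    (∑[ i < suc n ] f i when (i ≟ a)) + (∑[ i < suc n ] f i when classFrom? (a + k) i)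
      ≡⟨ ∑-distrib-+ (suc n) (λ i → f i when (i ≟ a)) (λ i → f i when classFrom? (a + k) i) ⟨
    ∑[ i < suc n ] f i when (i ≟ a) + f i when classFrom? (a + k) i
      ≡⟨ ∑-cong (suc n) (λ i _ → step i) ⟩
    ∑[ i < suc n ] f i when classFrom? a i ∎
    where
    open ≡-Reasoning
    level : f a ≡ ∑[ i < suc n ] f i when (i ≟ a)
    level with a ≤? n
    ... | yes a≤n = sym (∑-point (suc n) a f (s≤s a≤n))
    ... | no  a≰n = trans (f-vanish (≰⇒> a≰n)) (sym (∑-zero (suc n) λ i i<1+n →
                      when-no (f i) (i ≟ a) λ { refl → a≰n (s≤s⁻¹ i<1+n) }))
    [a+k]%k≡a%k : (a + k) % k ≡ a % k
    [a+k]%k≡a%k = [m+n]%n≡m%n a k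
    step : ∀ i → f i when (i ≟ a) + f i when classFrom? (a + k) i ≡ f i when classFrom? a i
    step i with <-cmp i a
    ... | tri< i<a _ _ = begin
      f i when (i ≟ a) + f i when classFrom? (a + k) i
        ≡⟨ cong₂ _+_ (when-no (f i) (i ≟ a) (<⇒≢ i<a))
                     (when-no (f i) (classFrom? (a + k) i) λ (a+k≤i , _) →
                        <⇒≱ i<a (≤-trans (m≤m+n a k) a+k≤i)) ⟩
      0
        ≡⟨ when-no (f i) (classFrom? a i) (λ (a≤i , _) → <⇒≱ i<a a≤i) ⟨
      f i when classFrom? a i ∎
    ... | tri≈ _ refl _ = begin
      f i when (i ≟ i) + f i when classFrom? (i + k) i
        ≡⟨ cong₂ _+_ (when-yes (f i) (i ≟ i) refl)
                     (when-no (f i) (classFrom? (i + k) i) λ (i+k≤i , _) →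
                        <⇒≱ (m<m+n i (>-nonZero⁻¹ k)) i+k≤i) ⟩
      f i + 0
        ≡⟨ +-identityʳ (f i) ⟩
      f i
        ≡⟨ when-yes (f i) (classFrom? i i) (≤-refl , refl) ⟨
      f i when classFrom? i i ∎
    ... | tri> _ _ a<i with i <? a + k
    ...   | yes i<a+k = begin
      f i when (i ≟ a) + f i when classFrom? (a + k) i
        ≡⟨ cong₂ _+_ (when-no (f i) (i ≟ a) (>⇒≢ a<i))
                     (when-no (f i) (classFrom? (a + k) i) λ (a+k≤i , _) → <⇒≱ i<a+k a+k≤i) ⟩
      0
        ≡⟨ when-no (f i) (classFrom? a i) (λ (_ , i%k≡a%k) →
             >⇒≢ a<i (%-injective-window k (<⇒≤ a<i) i<a+k i%k≡a%k)) ⟨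
      f i when classFrom? a i ∎
    ...   | no  i≮a+k = begin
      f i when (i ≟ a) + f i when classFrom? (a + k) i
        ≡⟨ cong (_+ f i when classFrom? (a + k) i) (when-no (f i) (i ≟ a) (>⇒≢ a<i)) ⟩
      f i when classFrom? (a + k) i
        ≡⟨ when-⇔ (f i) (classFrom? (a + k) i) (classFrom? a i)
                  (λ (_ , e) → <⇒≤ a<i , trans e [a+k]%k≡a%k)
                  (λ (_ , e) → ≮⇒≥ i≮a+k , trans e (sym [a+k]%k≡a%k)) ⟩
      f i when classFrom? a i ∎

  class≡progression : ∀ t → ∑[ i < suc n ] f i when (i % k ≟ t % k) ≡ ∑[ j < suc n ] f (t % k + j * k)
  class≡progression t = trans
    (∑-cong (suc n) λ i _ → when-⇔ (f i) (i % k ≟ t % k) (classFrom? (t % k) i)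
      (λ e → subst (_≤ i) e (m%n≤m i k) , trans e (sym (m%n%n≡m%n t k)))
      (λ (_ , e) → trans e (m%n%n≡m%n t k)))
    (sym (progression≡class-from (suc n) (t % k) (≤-trans (m≤m*n (suc n) k) (m≤n+m _ (t % k)))))

  module _ {P : ℕ → Set} (P? : Decidable P) where

    Meets : Set
    Meets = ∀ a → a + k ≤ suc n → ∃ λ i → a ≤ i × i < a + k × P i

    fᴾ : ℕ → ℕ
    fᴾ i = f i when P? i

    massFrom : ℕ → ℕ
    massFrom a = ∑[ i < suc n ∸ a ] fᴾ (a + i)

    massFrom-cons : ∀ {a} → a ≤ n → massFrom a ≡ fᴾ a + massFrom (suc a)
    massFrom-cons {a} a≤n rewrite +-∸-assoc 1 a≤n =
      cong₂ _+_ (cong fᴾ (+-identityʳ a)) (∑-cong (n ∸ a) λ i _ → cong fᴾ (+-suc a i))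

    massFrom-suc≤ : ∀ a → massFrom (suc a) ≤ massFrom a
    massFrom-suc≤ a with a ≤? n
    ... | yes a≤n = subst (massFrom (suc a) ≤_) (sym (massFrom-cons a≤n)) (m≤n+m _ (fᴾ a))
    ... | no  a≰n rewrite m≤n⇒m∸n≡0 (<⇒≤ (≰⇒> a≰n)) = z≤n

    massFrom-antimono : ∀ {a b} → a ≤ b → massFrom b ≤ massFrom a
    massFrom-antimono {a} {zero}  z≤n  = ≤-refl
    massFrom-antimono {a} {suc b} a≤1+b with m≤n⇒m<n∨m≡n a≤1+b
    ... | inj₂ refl = ≤-refl
    ... | inj₁ a<1+b = ≤-trans (massFrom-suc≤ b) (massFrom-antimono (s≤s⁻¹ a<1+b))

    mass-split : ∀ {t} → t ≤ suc n → ∑[ i < suc n ] fᴾ i ≡ ∑< t fᴾ + massFrom t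
    mass-split {t} t≤1+n = trans (cong (λ l → ∑< l fᴾ) (sym (m+[n∸m]≡n t≤1+n))) (∑-split t (suc n ∸ t) fᴾ)

    record Anchor : Set where
      field
        t     : ℕ
        t≤n   : t ≤ n
        Pt    : P t
        lower : ∀ {i} → i < t → P i → i + i ≤ n
        upper : ∀ {i} → t < i → i ≤ n → P i → n ≤ i + i

    module _ (meets : Meets) where

      ascend : ∀ F p → (∀ {i} → p < i → i ≤ n → P i → n ≤ i + i) →
               ∑[ j < F ] f (p + k + j * k) ≤ massFrom (suc p)
      ascend zero    p upper = z≤n
      ascend (suc F) p upper with p + k ≤? n
      ... | no  p+k≰n =
        ≤-trans (≤-reflexive (∑-zero (suc F) λ j _ → f-vanish (<-≤-trans (≰⇒> p+k≰n) (m≤m+n _ (j * k))))) z≤n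
      ... | yes p+k≤n with meets (suc p) (s≤s p+k≤n)
      ...   | t , p<t , t<1+p+k , Pt = begin
        ∑[ j < suc F ] f (p + k + j * k)                ≡⟨ ∑-progression-cons F (p + k) k f ⟩
        f (p + k) + (∑[ j < F ] f (p + k + k + j * k))
          ≤⟨ +-mono-≤ (f-antimono t≤p+k n≤2t) (∑-mono-≤ F λ j _ → f-antimono (shift j) (n≤2[t+k+jk] j)) ⟩
        f t + (∑[ j < F ] f (t + k + j * k))            ≤⟨ +-monoʳ-≤ (f t) (ascend F t λ t<i → upper (<-trans p<t t<i)) ⟩
        f t + massFrom (suc t)                          ≡⟨ cong (_+ massFrom (suc t)) (when-yes (f t) (P? t) Pt) ⟨
        fᴾ t + massFrom (suc t)                         ≡⟨ massFrom-cons t≤n ⟨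
        massFrom t                                      ≤⟨ massFrom-antimono p<t ⟩
        massFrom (suc p)                                ∎
        where
        open ≤-Reasoning
        t≤p+k = s≤s⁻¹ t<1+p+k
        t≤n   = ≤-trans t≤p+k p+k≤n
        n≤2t  = upper p<t t≤n Pt
        shift : ∀ j → t + k + j * k ≤ p + k + k + j * k
        shift j = +-monoˡ-≤ (j * k) (+-monoˡ-≤ k t≤p+k)
        n≤2[t+k+jk] : ∀ j → n ≤ (t + k + j * k) + (t + k + j * k)
        n≤2[t+k+jk] j = ≤-trans n≤2t (+-mono-≤ t≤t+k+jk t≤t+k+jk)
          where t≤t+k+jk = ≤-trans (m≤m+n t k) (m≤m+n (t + k) (j * k))

      descend : ∀ m r → r + m * k ≤ n → (∀ {i} → i < r + m * k → P i → i + i ≤ n) →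
                ∑[ j < m ] f (r + j * k) ≤ ∑< (r + m * k) fᴾ
      descend zero    r _ _ = z≤n
      descend (suc m) r q≤n lower with meets (r + m * k) a+k≤1+n
        where a+k≤1+n = ≤-trans (≤-reflexive (r+mk+k≡r+[1+m]k r m)) (m≤n⇒m≤1+n q≤n)
      ... | t , a≤t , t<a+k , Pt = begin
        ∑[ j < suc m ] f (r + j * k)              ≡⟨ ∑-snoc m (λ j → f (r + j * k)) ⟩
        (∑[ j < m ] f (r + j * k)) + f (r + m * k)
          ≤⟨ +-mono-≤ (∑-mono-≤ m λ j j<m → f-mono (+-monoˡ-≤ (j * k) r≤r′) (2[r′+jk]≤1+n j j<m))
                      (f-mono a≤t 2t≤1+n) ⟩
        (∑[ j < m ] f (r′ + j * k)) + f t
          ≤⟨ +-mono-≤ below-t (≤-reflexive (sym (when-yes (f t) (P? t) Pt))) ⟩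
        ∑< (r′ + m * k) fᴾ + fᴾ t                 ≡⟨ cong (λ l → ∑< l fᴾ + fᴾ t) r′+mk≡t ⟩
        ∑< t fᴾ + fᴾ t                            ≡⟨ ∑-snoc t fᴾ ⟨
        ∑< (suc t) fᴾ                             ≤⟨ ∑-mono-≤-range fᴾ t<q ⟩
        ∑< (r + suc m * k) fᴾ                     ∎
        where
        open ≤-Reasoning
        r′ = t ∸ m * k
        t<q    = <-≤-trans t<a+k (≤-reflexive (r+mk+k≡r+[1+m]k r m))
        t≤n    = ≤-trans (<⇒≤ t<q) q≤n
        2t≤n   = lower t<q Pt
        2t≤1+n = m≤n⇒m≤1+n 2t≤n
        mk≤t   = ≤-trans (m≤n+m (m * k) r) a≤t
        r′+mk≡t : r′ + m * k ≡ t
        r′+mk≡t = m∸n+n≡m mk≤t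
        r≤r′ : r ≤ r′
        r≤r′ = m+n≤o⇒m≤o∸n r a≤t
        2[r′+jk]≤1+n : ∀ j → j < m → (r′ + j * k) + (r′ + j * k) ≤ suc n
        2[r′+jk]≤1+n j j<m = ≤-trans (+-mono-≤ r′+jk≤t r′+jk≤t) 2t≤1+n
          where r′+jk≤t = ≤-trans (+-monoʳ-≤ r′ (*-monoˡ-≤ k (<⇒≤ j<m))) (≤-reflexive r′+mk≡t)
        below-t : ∑[ j < m ] f (r′ + j * k) ≤ ∑< (r′ + m * k) fᴾ
        below-t = descend m r′ (≤-trans (≤-reflexive r′+mk≡t) t≤n)
                    λ i<r′+mk → lower (<-trans (subst (_ <_) r′+mk≡t i<r′+mk) t<q)

      anchor : k ≤ n → Anchor
      anchor k≤n with last? (λ i → P? i ×-dec i + i ≤? n) (suc n)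
      ... | inj₂ (t , t<1+n , (Pt , 2t≤n) , after) = record
        { t = t ; t≤n = s≤s⁻¹ t<1+n ; Pt = Pt
        ; lower = λ i<t _ → ≤-trans (+-mono-≤ (<⇒≤ i<t) (<⇒≤ i<t)) 2t≤n
        ; upper = λ t<i i≤n Pi → <⇒≤ (≰⇒> λ 2i≤n → after t<i (s≤s i≤n) (Pi , 2i≤n))
        }
      ... | inj₁ noneLow with first? P? (suc n)
      ...   | inj₂ (t , t<1+n , Pt , before) = record
        { t = t ; t≤n = s≤s⁻¹ t<1+n ; Pt = Pt
        ; lower = λ i<t Pi → contradiction Pi (before i<t)
        ; upper = λ _ i≤n Pi → <⇒≤ (≰⇒> λ 2i≤n → noneLow (s≤s i≤n) (Pi , 2i≤n))
        }
      ...   | inj₁ none with meets 0 (m≤n⇒m≤1+n k≤n)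
      ...     | i , _ , i<k , Pi = contradiction Pi (none (<-≤-trans i<k (m≤n⇒m≤1+n k≤n)))

      class≤mass : k ≤ n → ∃ λ t → ∑[ i < suc n ] f i when (i % k ≟ t % k) ≤ ∑[ i < suc n ] fᴾ i
      class≤mass k≤n = t , (begin
        ∑[ i < suc n ] f i when (i % k ≟ t % k)
          ≡⟨ class≡progression t ⟩
        ∑[ j < suc n ] f (r + j * k)
          ≡⟨ cong (λ l → ∑[ j < l ] f (r + j * k)) (m+[n∸m]≡n m≤1+n) ⟨
        ∑[ j < m + (suc n ∸ m) ] f (r + j * k)
          ≡⟨ ∑-split m (suc n ∸ m) (λ j → f (r + j * k)) ⟩
        (∑[ j < m ] f (r + j * k)) + (∑[ j < suc n ∸ m ] f (r + (m + j) * k))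
          ≡⟨ cong ((∑[ j < m ] f (r + j * k)) +_) tail≡ ⟩
        (∑[ j < m ] f (r + j * k)) + (f t + (∑[ j < n ∸ m ] f (t + k + j * k)))
          ≤⟨ +-mono-≤ below-t (+-mono-≤ (≤-reflexive (sym (when-yes (f t) (P? t) Pt))) (ascend (n ∸ m) t upper)) ⟩
        ∑< (r + m * k) fᴾ + (fᴾ t + massFrom (suc t))
          ≡⟨ cong₂ _+_ (cong (λ l → ∑< l fᴾ) r+mk≡t) (sym (massFrom-cons t≤n)) ⟩
        ∑< t fᴾ + massFrom t
          ≡⟨ mass-split (m≤n⇒m≤1+n t≤n) ⟨
        ∑[ i < suc n ] fᴾ i ∎)
        where
        open ≤-Reasoning
        open Anchor (anchor k≤n)
        r = t % k
        m = t / k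
        r+mk≡t : r + m * k ≡ t
        r+mk≡t = sym (m≡m%n+[m/n]*n t k)
        m≤n = ≤-trans (m/n≤m t k) t≤n
        m≤1+n = m≤n⇒m≤1+n m≤n
        below-t : ∑[ j < m ] f (r + j * k) ≤ ∑< (r + m * k) fᴾ
        below-t = descend m r (≤-trans (≤-reflexive r+mk≡t) t≤n) λ i<r+mk → lower (subst (_ <_) r+mk≡t i<r+mk)
        tail≡ : ∑[ j < suc n ∸ m ] f (r + (m + j) * k) ≡ f t + (∑[ j < n ∸ m ] f (t + k + j * k))
        tail≡ = begin-equality
          ∑[ j < suc n ∸ m ] f (r + (m + j) * k)  ≡⟨ cong (λ l → ∑[ j < l ] f (r + (m + j) * k)) (+-∸-assoc 1 m≤n) ⟩
          ∑[ j < suc (n ∸ m) ] f (r + (m + j) * k) ≡⟨ ∑-cong (suc (n ∸ m)) (λ j _ → cong f (shift j)) ⟩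
          ∑[ j < suc (n ∸ m) ] f (t + j * k)       ≡⟨ ∑-progression-cons (n ∸ m) t k f ⟩
          f t + (∑[ j < n ∸ m ] f (t + k + j * k)) ∎
          where
          shift : ∀ j → r + (m + j) * k ≡ t + j * k
          shift j = trans (cong (r +_) (*-distribʳ-+ k m j))
                          (trans (sym (+-assoc r (m * k) (j * k))) (cong (_+ j * k) r+mk≡t))

-- The extremal sets

module _ (k n : ℕ) .{{_ : NonZero k}} where

  total : ℕ
  total = ∑[ i < suc n ] n C i

  classSum : ℕ → ℕ
  classSum t = ∑[ i < suc n ] (n C i) when (i % k ≟ t % k)

  sumNotCong≡∑ : ∀ t → sumNotCong k n t ≡ ∑[ i < suc n ] (n C i) when ¬? (i % k ≟ t % k)
  sumNotCong≡∑ t = trans (cong sum (map-upTo (λ i → if i % k ≡ᵇ t % k then 0 else n C i) (suc n)))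
                         (∑-cong (suc n) λ i _ → sym (if-not (i % k ≡ᵇ t % k) {n C i} {0}))

  total≡classSum+sumNotCong : ∀ t → total ≡ classSum t + sumNotCong k n t
  total≡classSum+sumNotCong t = begin
    total
      ≡⟨ ∑-cong (suc n) (λ i _ → when-+-when-¬ (n C i) (i % k ≟ t % k)) ⟨
    ∑[ i < suc n ] (n C i) when (i % k ≟ t % k) + (n C i) when ¬? (i % k ≟ t % k)
      ≡⟨ ∑-distrib-+ (suc n) (λ i → (n C i) when (i % k ≟ t % k)) (λ i → (n C i) when ¬? (i % k ≟ t % k)) ⟩
    classSum t + (∑[ i < suc n ] (n C i) when ¬? (i % k ≟ t % k))
      ≡⟨ cong (classSum t +_) (sumNotCong≡∑ t) ⟨
    classSum t + sumNotCong k n t ∎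
    where open ≡-Reasoning

  sumNotCong-cong : ∀ {a b} → a % k ≡ b % k → sumNotCong k n a ≡ sumNotCong k n b
  sumNotCong-cong = cong λ r → sum (map (λ i → if i % k ≡ᵇ r then 0 else n C i) (upTo (suc n)))

  rhs≡foldr-⊔ : rhs k n ≡ foldr _⊔_ 0 (applyUpTo (λ j → sumNotCong k n (suc j)) k)
  rhs≡foldr-⊔ = cong (foldr _⊔_ 0) (map-upTo (λ j → sumNotCong k n (suc j)) k)

  residue-as-suc : ∀ t → ∃ λ j → j < k × suc j % k ≡ t % k
  residue-as-suc t with t % k | m%n<n t k
  ... | zero  | _   = pred k , ≤-reflexive (suc-pred k) , trans (cong (_% k) (suc-pred k)) (n%n≡0 k)
  ... | suc r | r<k = r , <-trans (n<1+n r) r<k , m<n⇒m%n≡m r<k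

  sumNotCong≤rhs : ∀ t → sumNotCong k n t ≤ rhs k n
  sumNotCong≤rhs t with residue-as-suc t
  ... | j , j<k , [1+j]%k≡t%k = begin
    sumNotCong k n t                                          ≡⟨ sumNotCong-cong [1+j]%k≡t%k ⟨
    sumNotCong k n (suc j)                                    ≤⟨ ≤-foldr-⊔ k (λ j → sumNotCong k n (suc j)) j<k ⟩
    foldr _⊔_ 0 (applyUpTo (λ j → sumNotCong k n (suc j)) k)  ≡⟨ rhs≡foldr-⊔ ⟨
    rhs k n                                                   ∎
    where open ≤-Reasoning

  rhs-attained : ∃ λ t → rhs k n ≡ sumNotCong k n t
  rhs-attained with foldr-⊔-attained (pred k) (λ j → sumNotCong k n (suc j))
  ... | j , _ , max≡ = suc j , trans rhs≡foldr-⊔ (subst (λ l → foldr _⊔_ 0 (applyUpTo g l) ≡ g j) (suc-pred k) max≡)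
    where
    g : ℕ → ℕ
    g j = sumNotCong k n (suc j)

  avoidingLevels : ℕ → VertexSet n
  avoidingLevels r v = does (¬? (∣ v ∣ % k ≟ r))

  size-avoidingLevels : ∀ t → size (avoidingLevels (t % k)) ≡ sumNotCong k n t
  size-avoidingLevels t = begin
    size (avoidingLevels (t % k))
      ≡⟨ sum-allVertices n (λ v → 1 when ¬? (∣ v ∣ % k ≟ t % k)) ⟩
    ∑ᵥ n (λ v → 1 when ¬? (∣ v ∣ % k ≟ t % k))
      ≡⟨ ∑ᵥ-by-level n (suc n) (λ i → 1 when ¬? (i % k ≟ t % k)) ≤-refl ⟩
    ∑[ i < suc n ] (n C i) * (1 when ¬? (i % k ≟ t % k))
      ≡⟨ ∑-cong (suc n) (λ i _ → trans (*-distribˡ-when (n C i) 1 (¬? (i % k ≟ t % k)))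
                                         (cong (_when ¬? (i % k ≟ t % k)) (*-identityʳ (n C i)))) ⟩
    ∑[ i < suc n ] (n C i) when ¬? (i % k ≟ t % k)
      ≡⟨ sumNotCong≡∑ t ⟨
    sumNotCong k n t ∎
    where open ≡-Reasoning

  avoidingLevels-pathFree : ∀ {r} → r < k → PathFree k (avoidingLevels r)
  avoidingLevels-pathFree {r} r<k (f , _ , f-in , f-edge) with residue-within k ∣ f v₀ ∣ r<k
    where v₀ = fromℕ< (>-nonZero⁻¹ k)
  ... | m , m<k , [∣v₀∣+m]%k≡r =
    T-¬?⇒¬ (∣ f vₘ ∣ % k ≟ r) (f-in vₘ) (trans (cong (_% k) ∣vₘ∣≡∣v₀∣+m) [∣v₀∣+m]%k≡r)
    where
    vₘ = fromℕ< m<k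
    ∣vₘ∣≡∣v₀∣+m = path-level f f-edge m (trans (toℕ-fromℕ< m<k) (cong (_+ m) (sym (toℕ-fromℕ< _))))

  open WindowHitting n k (n C_) nCk-mono-≤ nCk-antimono-≤ k>n⇒nCk≡0

  module _ (k≤n : k ≤ n) (U : VertexSet n) (U-free : PathFree k U) where

    chain-meets : ∀ {σ} → IsMaximalChain σ → Meets (λ i → ¬? (T? (U (σ i))))
    chain-meets {σ} σ-max a a+k≤1+n with first? (λ i → a ≤? i ×-dec ¬? (T? (U (σ i)))) (a + k)
    ... | inj₂ (i , i<a+k , (a≤i , σi∉U) , _) = i , a≤i , i<a+k , σi∉U
    ... | inj₁ none = contradiction window-path U-free
      where
      open IsMaximalChain σ-max
      window : Fin k → Vertex n
      window j = σ (a + toℕ j)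
      a+j<a+k : ∀ j → a + toℕ j < a + k
      a+j<a+k j = +-monoʳ-< a (toℕ<n j)
      a+j≤n : ∀ j → a + toℕ j ≤ n
      a+j≤n j = s≤s⁻¹ (<-≤-trans (a+j<a+k j) a+k≤1+n)
      window-injective : Injective _≡_ _≡_ window
      window-injective {i} {j} wi≡wj = toℕ-injective (+-cancelˡ-≡ a (toℕ i) (toℕ j)
        (trans (sym (∣σ∣≡ (a+j≤n i))) (trans (cong ∣_∣ wi≡wj) (∣σ∣≡ (a+j≤n j)))))
      window-in : ∀ j → T (U (window j))
      window-in j = decidable-stable (T? _) λ σ∉U → none (a+j<a+k j) (m≤m+n a (toℕ j) , σ∉U)
      window-edge : ∀ i j → toℕ j ≡ suc (toℕ i) → Edge (window i) (window j)
      window-edge i j j≡1+i =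
        subst (Edge (window i) ∘ σ) a+1+i≡a+j (edge (subst (_≤ n) (sym a+1+i≡a+j) (a+j≤n j)))
        where a+1+i≡a+j = trans (sym (+-suc a (toℕ i))) (cong (a +_) (sym j≡1+i))
      window-path : ContainsPath k U
      window-path = window , window-injective , window-in , window-edge

    outsideWeight : Chain n → ℕ
    outsideWeight σ = ∑[ i < suc n ] (n C i) when ¬? (T? (U (σ i)))

    complementSize : ℕ
    complementSize = ∑ᵥ n (λ v → 1 when ¬? (T? (U v)))

    total∸rhs≤outsideWeight : ∀ σ → IsMaximalChain σ → total ∸ rhs k n ≤ outsideWeight σ
    total∸rhs≤outsideWeight σ σ-max with class≤mass (λ i → ¬? (T? (U (σ i)))) (chain-meets σ-max) k≤n
    ... | t , classSum≤weight = m≤n+o⇒m∸n≤o _ (rhs k n) (begin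
      total                          ≡⟨ total≡classSum+sumNotCong t ⟩
      classSum t + sumNotCong k n t  ≤⟨ +-mono-≤ classSum≤weight (sumNotCong≤rhs t) ⟩
      outsideWeight σ + rhs k n      ≡⟨ +-comm (outsideWeight σ) (rhs k n) ⟩
      rhs k n + outsideWeight σ      ∎)
      where open ≤-Reasoning

    ∑ᶜ-outsideWeight : ∑ᶜ n outsideWeight ≡ n ! * complementSize
    ∑ᶜ-outsideWeight = begin
      ∑ᶜ n outsideWeight
        ≡⟨ ∑ᶜ-by-vertex n (λ i B → (n C i) when ¬? (T? (U B))) ⟩
      ∑ᵥ n (λ B → ∣ B ∣ ! * (n ∸ ∣ B ∣) ! * ((n C ∣ B ∣) when ¬? (T? (U B))))
        ≡⟨ ∑ᵥ-cong n (λ B → chains-through B (¬? (T? (U B)))) ⟩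
      ∑ᵥ n (λ B → n ! * (1 when ¬? (T? (U B))))
        ≡⟨ ∑ᵥ-distribˡ-* n (n !) _ ⟩
      n ! * complementSize ∎
      where
      open ≡-Reasoning
      chains-through : ∀ B {P : Set} (P? : Dec P) →
                       ∣ B ∣ ! * (n ∸ ∣ B ∣) ! * ((n C ∣ B ∣) when P?) ≡ n ! * (1 when P?)
      chains-through B P? = begin
        c! * ((n C ∣ B ∣) when P?)    ≡⟨ *-distribˡ-when c! (n C ∣ B ∣) P? ⟩
        (c! * (n C ∣ B ∣)) when P?    ≡⟨ cong (_when P?) (*-comm c! (n C ∣ B ∣)) ⟩
        ((n C ∣ B ∣) * c!) when P?    ≡⟨ cong (_when P?) (nCk*k![n∸k]!≡n! (∣p∣≤n B)) ⟩
        n ! when P?                   ≡⟨ cong (_when P?) (*-identityʳ (n !)) ⟨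
        (n ! * 1) when P?             ≡⟨ *-distribˡ-when (n !) 1 P? ⟨
        n ! * (1 when P?)             ∎
        where c! = ∣ B ∣ ! * (n ∸ ∣ B ∣) !

    size+complementSize≡total : size U + complementSize ≡ total
    size+complementSize≡total = begin
      size U + complementSize
        ≡⟨ cong (_+ complementSize) (sum-allVertices n (λ v → 1 when T? (U v))) ⟩
      ∑ᵥ n (λ v → 1 when T? (U v)) + complementSize
        ≡⟨ ∑ᵥ-distrib-+ n (λ v → 1 when T? (U v)) (λ v → 1 when ¬? (T? (U v))) ⟨
      ∑ᵥ n (λ v → 1 when T? (U v) + 1 when ¬? (T? (U v)))
        ≡⟨ ∑ᵥ-cong n (λ v → when-+-when-¬ 1 (T? (U v))) ⟩
      ∑ᵥ n (λ _ → 1)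
        ≡⟨ ∑ᵥ-by-level n (suc n) (λ _ → 1) ≤-refl ⟩
      ∑[ i < suc n ] (n C i) * 1
        ≡⟨ ∑-cong (suc n) (λ i _ → *-identityʳ (n C i)) ⟩
      total ∎
      where open ≡-Reasoning

    size≤rhs : size U ≤ rhs k n
    size≤rhs = +-cancelʳ-≤ complementSize (size U) (rhs k n) (begin
      size U + complementSize      ≡⟨ size+complementSize≡total ⟩
      total                        ≤⟨ m≤n+m∸n total (rhs k n) ⟩
      rhs k n + (total ∸ rhs k n)  ≤⟨ +-monoʳ-≤ (rhs k n) total∸rhs≤complementSize ⟩
      rhs k n + complementSize     ∎)
      where
      open ≤-Reasoning
      total∸rhs≤complementSize : total ∸ rhs k n ≤ complementSize
      total∸rhs≤complementSize = *-cancelˡ-≤ (n !) {{n !≢0}} (begin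
        n ! * (total ∸ rhs k n)       ≡⟨ ∑ᶜ-const n (total ∸ rhs k n) ⟨
        ∑ᶜ n (λ _ → total ∸ rhs k n)  ≤⟨ ∑ᶜ-mono-≤ n total∸rhs≤outsideWeight ⟩
        ∑ᶜ n outsideWeight            ≡⟨ ∑ᶜ-outsideWeight ⟩
        n ! * complementSize          ∎)

theorem1p4 : (k n : ℕ) → .{{_ : NonZero k}} → k ≤ n → IsExV k n (rhs k n)
theorem1p4 k n k≤n with rhs-attained k n
... | t , rhs≡sumNotCong =
  ( avoidingLevels k n (t % k)
  , avoidingLevels-pathFree k n (m%n<n t k)
  , trans (size-avoidingLevels k n t) (sym rhs≡sumNotCong) )
  , λ U U-free → size≤rhs k n k≤n U U-free
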